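{- Let $n\ge 1$ and $k\ge 1$ be integers with $k\le n/2$. (i) Let $D\subseteq F_2^n$ be an antipodal $(2k+1)$-design. Let $C\subseteq F_2^n$ be formed by choosing, from each pair $\{x,-x\}$ of antipodal points of $D$, exactly one of the points $x$, $-x$. Then $C$ is a $(k,k)$-design. (ii) Conversely, if $C\subseteq F_2^n$ is a $(k,k)$-design which contains no pair of antipodal points (i.e., there is no $x$ with both $x\in C$ and $-x\in C$), then $D=C\cup(-C)$ is an antipodal $(2k+1)$-design in $F_2^n$.
   Context: $F_2^n$ is the set of binary vectors of length $n$ over $\{0,1\}$, with Hamming distance $d(x,y)$ (number of coordinates where $x,y$ differ). Define the "inner product" $\langle x,y\rangle:=1-\frac{2d(x,y)}{n}$. The Krawtchouk polynomials $Q_i^{(n)}(t)$, $i=0,\dots,n$, are defined by $Q_0^{(n)}(t)=1$, $Q_1^{(n)}(t)=t$ and $ntQ_i^{(n)}(t)=(n-i)Q_{i+1}^{(n)}(t)+iQ_{i-1}^{(n)}(t)$ for $i=1,\dots,n-1$. A code is a nonempty subset $C\subseteq F_2^n$; its moments are $M_i(C):=\sum_{x,y\in C}Q_i^{(n)}(\langle x,y\rangle)$ (sum over all ordered pairs, including $x=y$), $i=1,\dots,n$; these are always $\ge 0$. For $1\le m\le n$, $C$ is an $m$-design if $M_i(C)=0$ for all $i=1,\dots,m$; equivalently, in the matrix whose rows are the codewords, any $m$ columns contain every $m$-tuple of $\{0,1\}^m$ equally often (a binary orthogonal array of strength $m$). For a positive integer $k\le n/2$, $C$ is a $(k,k)$-design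 if $M_i(C)=0$ for all $i\in\{2,4,\dots,2k\}$. For $x\in F_2^n$, $-x$ denotes the unique point with $d(x,-x)=n$ (the complement of $x$), and $-C=\{ -x:x\in C\}$. A code $C$ is antipodal if $x\in C$ implies $-x\in C$. -}

module Defs where

open import Data.Bool using (Bool; true; false; not; _∧_; if_then_else_)
open import Data.Nat as ℕ using (ℕ; zero; suc; _∸_; _≤_; NonZero)
open import Data.Integer as ℤ using (ℤ; +_)
open import Data.Rational as ℚ using (ℚ; 0ℚ; 1ℚ; _+_; _*_; _-_)
open import Data.List using (List; []; _∷_; _++_; map; foldr)
open import Data.Vec using (Vec; []; _∷_)
import Data.Vec as Vec
open import Data.Product using (_×_; _,_; proj₁; ∃)
open import Relation.Binary.PropositionalEquality using (_≡_)

F2 : ℕ → Set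
F2 n = Vec Bool n

allVecs : (n : ℕ) → List (F2 n)
allVecs zero = [] ∷ []
allVecs (suc n) = map (false ∷_) (allVecs n) ++ map (true ∷_) (allVecs n)

Code : ℕ → Set
Code n = F2 n → Bool

_∈C_ : {n : ℕ} → F2 n → Code n → Set
x ∈C C = C x ≡ true

NonemptyCode : {n : ℕ} → Code n → Set
NonemptyCode {n} C = ∃ λ (x : F2 n) → x ∈C C

hamming : {n : ℕ} → F2 n → F2 n → ℕ
hamming [] [] = 0
hamming (a ∷ x) (b ∷ y) = (if a Data.Bool.xor b then 1 else 0) ℕ.+ hamming x y
  where import Data.Bool

-- complement -x  (the unique point at distance n from x)
neg : {n : ℕ} → F2 n → F2 n
neg = Vec.map not

negC : {n : ℕ} → Code n → Code n
negC C x = C (neg x)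

inner : (n : ℕ) .{{_ : NonZero n}} → F2 n → F2 n → ℚ
inner n x y = 1ℚ - ((+ (2 ℕ.* hamming x y)) ℚ./ n)

-- Krawtchouk polynomials via the three-term recurrence
--   n t Q_i = (n-i) Q_{i+1} + i Q_{i-1}.
-- kstep n j t a b computes Q_{j+1}(t) from a = Q_{j-1}(t), b = Q_j(t)
-- (for j ≤ n-1; for j ≥ n, where the recurrence gives nothing, we put 0).
kstep : ℕ → ℕ → ℚ → ℚ → ℚ → ℚ
kstep n j t a b with n ∸ j
... | zero = 0ℚ
... | suc m = ((+ n ℚ./ 1) * t * b - (+ j ℚ./ 1) * a) * (+ 1 ℚ./ suc m)

kpair : ℕ → ℕ → ℚ → ℚ × ℚ
kpair n zero t = 1ℚ , t
kpair n (suc i) t with kpair n i t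
... | (a , b) = b , kstep n (suc i) t a b

Krawtchouk : (n i : ℕ) → ℚ → ℚ
Krawtchouk n i t = proj₁ (kpair n i t)

sumℚ : List ℚ → ℚ
sumℚ = foldr _+_ 0ℚ

-- M_i(C) = Σ_{x,y ∈ C} Q_i(<x,y>)  (ordered pairs, including x = y)
moment : (n : ℕ) .{{_ : NonZero n}} → ℕ → Code n → ℚ
moment n i C =
  sumℚ (map (λ x → sumℚ (map (λ y →
      if C x ∧ C y then Krawtchouk n i (inner n x y) else 0ℚ) (allVecs n))) (allVecs n))

-- m-design: M_i(C) = 0 for all i = 1..m  (indices restricted to i ≤ n,
-- where Q_i is defined)
IsDesign : (n : ℕ) .{{_ : NonZero n}} → ℕ → Code n → Set
IsDesign n m C = NonemptyCode C ×
  ((i : ℕ) → 1 ≤ i → i ≤ m → i ≤ n → moment n i C ≡ 0ℚ)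

IsKKDesign : (n : ℕ) .{{_ : NonZero n}} → ℕ → Code n → Set
IsKKDesign n k C = NonemptyCode C ×
  ((j : ℕ) → 1 ≤ j → j ≤ k → moment n (2 ℕ.* j) C ≡ 0ℚ)

IsAntipodal : {n : ℕ} → Code n → Set
IsAntipodal {n} C = (x : F2 n) → x ∈C C → neg x ∈C C

_∪C_ : {n : ℕ} → Code n → Code n → Code n
(C ∪C D) x = C x Data.Bool.∨ D x
  where import Data.Bool

-- Write 1_C for the indicator of a code. In both parts D is the disjoint union of C and −C, so
-- 1_D = 1_C + 1_C ∘ neg. The moment M_i is the quadratic form of the kernel
-- K(x,y) = Q_i(⟨x,y⟩), and complementing either argument negates ⟨x,y⟩, while Q_i has the
-- parity of i; hence K(−x,y) = K(x,−y) = (−1)^i K(x,y). Expanding the form gives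
-- M_i(D) = (1 + (−1)^i)² M_i(C): odd moments of D vanish and M_{2j}(D) = 4 M_{2j}(C).
module Submission where

open import Defs
open import Data.Bool using (Bool; true; false; not; _∧_; _∨_; if_then_else_)
import Data.Bool.Properties as Bool
open import Data.Empty using (⊥; ⊥-elim)
open import Data.Integer using (+_)
import Data.Integer as ℤ
import Data.Integer.Properties as ℤ
import Data.Integer.Solver as ℤ-Solver
open import Data.List using (List; []; _∷_; _++_; map)
import Data.List.Properties as List
open import Data.Nat using (ℕ; zero; suc; NonZero; _≤_; z≤n; s≤s; _*_; _+_; _∸_)
import Data.Nat.Properties as ℕ
open import Data.Product using (_×_; _,_; proj₁; proj₂; ∃)
open import Data.Rational using (ℚ; 0ℚ; 1ℚ; _-_; -_) renaming (_+_ to _+ℚ_; _*_ to _*ℚ_)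
import Data.Rational as ℚ
import Data.Rational.Properties as ℚ
open import Algebra.Properties.Group ℚ.+-0-group using () renaming (⁻¹-involutive to -‿involutive)
open import Data.Rational.Solver using (module +-*-Solver)
open +-*-Solver using (solve; _:+_; _:*_; :-_; _:-_; _:=_; con)
import Data.Rational.Unnormalised as ℚᵘ
import Data.Rational.Unnormalised.Properties as ℚᵘ
open import Data.Sum using (_⊎_; inj₁; inj₂)
open import Data.Vec using ([]; _∷_)
open import Relation.Binary.PropositionalEquality
  using (_≡_; refl; sym; trans; cong; cong₂; subst; module ≡-Reasoning)

sumℚ-++ : (xs ys : List ℚ) → sumℚ (xs ++ ys) ≡ sumℚ xs +ℚ sumℚ ys
sumℚ-++ []       ys = sym (ℚ.+-identityˡ _)
sumℚ-++ (x ∷ xs) ys = trans (cong (x +ℚ_) (sumℚ-++ xs ys)) (sym (ℚ.+-assoc x _ _))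

sumℚ-map-+ : {A : Set} (f g : A → ℚ) (xs : List A) →
  sumℚ (map (λ x → f x +ℚ g x) xs) ≡ sumℚ (map f xs) +ℚ sumℚ (map g xs)
sumℚ-map-+ f g []       = refl
sumℚ-map-+ f g (x ∷ xs) rewrite sumℚ-map-+ f g xs =
  +-interchange (f x) (g x) (sumℚ (map f xs)) (sumℚ (map g xs))
  where
  +-interchange : ∀ a b c d → (a +ℚ b) +ℚ (c +ℚ d) ≡ (a +ℚ c) +ℚ (b +ℚ d)
  +-interchange = solve 4 (λ a b c d → (a :+ b) :+ (c :+ d) := (a :+ c) :+ (b :+ d)) refl

sumℚ-map-* : {A : Set} (c : ℚ) (f : A → ℚ) (xs : List A) →
  sumℚ (map (λ x → c *ℚ f x) xs) ≡ c *ℚ sumℚ (map f xs)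
sumℚ-map-* c f []       = sym (ℚ.*-zeroʳ c)
sumℚ-map-* c f (x ∷ xs) rewrite sumℚ-map-* c f xs = sym (ℚ.*-distribˡ-+ c (f x) _)

-- Opaque, so that unification does not unfold ∑ f and can still infer the summand f.
opaque
  ∑ : {n : ℕ} → (F2 n → ℚ) → ℚ
  ∑ {n} f = sumℚ (map f (allVecs n))

  ∑-cong : {n : ℕ} {f g : F2 n → ℚ} → (∀ x → f x ≡ g x) → ∑ f ≡ ∑ g
  ∑-cong {n} f≗g = cong sumℚ (List.map-cong f≗g (allVecs n))

  ∑-+ : {n : ℕ} (f g : F2 n → ℚ) → ∑ (λ x → f x +ℚ g x) ≡ ∑ f +ℚ ∑ g
  ∑-+ {n} f g = sumℚ-map-+ f g (allVecs n)

  ∑-* : {n : ℕ} (c : ℚ) (f : F2 n → ℚ) → ∑ (λ x → c *ℚ f x) ≡ c *ℚ ∑ f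
  ∑-* {n} c f = sumℚ-map-* c f (allVecs n)

  ∑-∷ : {n : ℕ} (f : F2 (suc n) → ℚ) → ∑ f ≡ ∑ (λ v → f (false ∷ v)) +ℚ ∑ (λ v → f (true ∷ v))
  ∑-∷ {n} f = begin
    sumℚ (map f (map (false ∷_) vs ++ map (true ∷_) vs))
      ≡⟨ cong sumℚ (List.map-++ f (map (false ∷_) vs) _) ⟩
    sumℚ (map f (map (false ∷_) vs) ++ map f (map (true ∷_) vs))
      ≡⟨ sumℚ-++ (map f (map (false ∷_) vs)) _ ⟩
    sumℚ (map f (map (false ∷_) vs)) +ℚ sumℚ (map f (map (true ∷_) vs))
      ≡⟨ cong₂ _+ℚ_ (cong sumℚ (sym (List.map-∘ vs))) (cong sumℚ (sym (List.map-∘ vs))) ⟩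
    ∑ (λ v → f (false ∷ v)) +ℚ ∑ (λ v → f (true ∷ v)) ∎
    where
    vs : List (F2 n)
    vs = allVecs n
    open ≡-Reasoning

  ∑-neg : {n : ℕ} (f : F2 n → ℚ) → ∑ (λ x → f (neg x)) ≡ ∑ f
  ∑-neg {zero}  f = refl
  ∑-neg {suc n} f = begin
    ∑ (λ x → f (neg x))
      ≡⟨ ∑-∷ (λ x → f (neg x)) ⟩
    ∑ (λ v → f (true ∷ neg v)) +ℚ ∑ (λ v → f (false ∷ neg v))
      ≡⟨ cong₂ _+ℚ_ (∑-neg (λ v → f (true ∷ v))) (∑-neg (λ v → f (false ∷ v))) ⟩
    ∑ (λ v → f (true ∷ v)) +ℚ ∑ (λ v → f (false ∷ v))
      ≡⟨ ℚ.+-comm (∑ (λ v → f (true ∷ v))) _ ⟩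
    ∑ (λ v → f (false ∷ v)) +ℚ ∑ (λ v → f (true ∷ v))
      ≡⟨ sym (∑-∷ f) ⟩
    ∑ f ∎
    where open ≡-Reasoning

neg-involutive : {n : ℕ} (x : F2 n) → neg (neg x) ≡ x
neg-involutive []      = refl
neg-involutive (a ∷ x) = cong₂ _∷_ (Bool.not-involutive a) (neg-involutive x)

-- Quadratic forms on functions F₂ⁿ → ℚ

form : {n : ℕ} → (F2 n → F2 n → ℚ) → (F2 n → ℚ) → (F2 n → ℚ) → ℚ
form K u v = ∑ (λ x → ∑ (λ y → u x *ℚ v y *ℚ K x y))

module _ {n : ℕ} (K : F2 n → F2 n → ℚ) where

  form-cong : {u u′ v v′ : F2 n → ℚ} → (∀ x → u x ≡ u′ x) → (∀ y → v y ≡ v′ y) →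
    form K u v ≡ form K u′ v′
  form-cong u≗u′ v≗v′ =
    ∑-cong (λ x → ∑-cong (λ y → cong₂ (λ a b → a *ℚ b *ℚ K x y) (u≗u′ x) (v≗v′ y)))

  form-+ˡ : (u₁ u₂ v : F2 n → ℚ) → form K (λ x → u₁ x +ℚ u₂ x) v ≡ form K u₁ v +ℚ form K u₂ v
  form-+ˡ u₁ u₂ v =
    trans (∑-cong (λ x → trans (∑-cong (λ y → distrib (u₁ x) (u₂ x) (v y) (K x y))) (∑-+ _ _)))
          (∑-+ _ _)
    where
    distrib : ∀ a b c k → (a +ℚ b) *ℚ c *ℚ k ≡ a *ℚ c *ℚ k +ℚ b *ℚ c *ℚ k
    distrib = solve 4 (λ a b c k → (a :+ b) :* c :* k := a :* c :* k :+ b :* c :* k) refl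

  form-+ʳ : (u v₁ v₂ : F2 n → ℚ) → form K u (λ y → v₁ y +ℚ v₂ y) ≡ form K u v₁ +ℚ form K u v₂
  form-+ʳ u v₁ v₂ =
    trans (∑-cong (λ x → trans (∑-cong (λ y → distrib (u x) (v₁ y) (v₂ y) (K x y))) (∑-+ _ _)))
          (∑-+ _ _)
    where
    distrib : ∀ a b c k → a *ℚ (b +ℚ c) *ℚ k ≡ a *ℚ b *ℚ k +ℚ a *ℚ c *ℚ k
    distrib = solve 4 (λ a b c k → a :* (b :+ c) :* k := a :* b :* k :+ a :* c :* k) refl

  private
    pull-scalar : ∀ a b s k → a *ℚ b *ℚ (s *ℚ k) ≡ s *ℚ (a *ℚ b *ℚ k)
    pull-scalar = solve 4 (λ a b s k → a :* b :* (s :* k) := s :* (a :* b :* k)) refl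

  form-negˡ : (s : ℚ) → (∀ x y → K (neg x) y ≡ s *ℚ K x y) →
    (u v : F2 n → ℚ) → form K (λ x → u (neg x)) v ≡ s *ℚ form K u v
  form-negˡ s K-negˡ u v = begin
    ∑ (λ x → ∑ (λ y → u (neg x) *ℚ v y *ℚ K x y))
      ≡⟨ sym (∑-neg _) ⟩
    ∑ (λ x → ∑ (λ y → u (neg (neg x)) *ℚ v y *ℚ K (neg x) y))
      ≡⟨ ∑-cong (λ x → trans (∑-cong (λ y → trans
           (cong₂ (λ a k → a *ℚ v y *ℚ k) (cong u (neg-involutive x)) (K-negˡ x y))
           (pull-scalar (u x) (v y) s (K x y)))) (∑-* s _)) ⟩
    ∑ (λ x → s *ℚ ∑ (λ y → u x *ℚ v y *ℚ K x y))
      ≡⟨ ∑-* s _ ⟩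
    s *ℚ form K u v ∎
    where open ≡-Reasoning

  form-negʳ : (s : ℚ) → (∀ x y → K x (neg y) ≡ s *ℚ K x y) →
    (u v : F2 n → ℚ) → form K u (λ y → v (neg y)) ≡ s *ℚ form K u v
  form-negʳ s K-negʳ u v = begin
    ∑ (λ x → ∑ (λ y → u x *ℚ v (neg y) *ℚ K x y))
      ≡⟨ ∑-cong (λ x → trans (sym (∑-neg _)) (trans (∑-cong (λ y → trans
           (cong₂ (λ b k → u x *ℚ b *ℚ k) (cong v (neg-involutive y)) (K-negʳ x y))
           (pull-scalar (u x) (v y) s (K x y)))) (∑-* s _))) ⟩
    ∑ (λ x → s *ℚ ∑ (λ y → u x *ℚ v y *ℚ K x y))
      ≡⟨ ∑-* s _ ⟩
    s *ℚ form K u v ∎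
    where open ≡-Reasoning

  form-symmetrise : (s : ℚ) →
    (∀ x y → K (neg x) y ≡ s *ℚ K x y) → (∀ x y → K x (neg y) ≡ s *ℚ K x y) →
    (u : F2 n → ℚ) → let ũ = λ x → u x +ℚ u (neg x) in
    form K ũ ũ ≡ (1ℚ +ℚ s) *ℚ (1ℚ +ℚ s) *ℚ form K u u
  form-symmetrise s K-negˡ K-negʳ u = begin
    form K ũ ũ
      ≡⟨ form-+ˡ u ū ũ ⟩
    form K u ũ +ℚ form K ū ũ
      ≡⟨ cong₂ _+ℚ_ (form-+ʳ u u ū) (form-+ʳ ū u ū) ⟩
    (F +ℚ form K u ū) +ℚ (form K ū u +ℚ form K ū ū)
      ≡⟨ cong₂ (λ a b → (F +ℚ a) +ℚ b) (form-negʳ s K-negʳ u u)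
           (cong₂ _+ℚ_ (form-negˡ s K-negˡ u u)
                       (trans (form-negˡ s K-negˡ u ū) (cong (s *ℚ_) (form-negʳ s K-negʳ u u)))) ⟩
    (F +ℚ s *ℚ F) +ℚ (s *ℚ F +ℚ s *ℚ (s *ℚ F))
      ≡⟨ expand s F ⟩
    (1ℚ +ℚ s) *ℚ (1ℚ +ℚ s) *ℚ F ∎
    where
    open ≡-Reasoning
    ũ ū : F2 n → ℚ
    ũ x = u x +ℚ u (neg x)
    ū x = u (neg x)
    F = form K u u
    expand : ∀ s m → (m +ℚ s *ℚ m) +ℚ (s *ℚ m +ℚ s *ℚ (s *ℚ m)) ≡ (1ℚ +ℚ s) *ℚ (1ℚ +ℚ s) *ℚ m
    expand = solve 2 (λ s m → (m :+ s :* m) :+ (s :* m :+ s :* (s :* m))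
                              := (con 1ℚ :+ s) :* (con 1ℚ :+ s) :* m) refl

-- Krawtchouk polynomials have the parity of their degree

sign : ℕ → ℚ
sign zero    = 1ℚ
sign (suc i) = - sign i

sign-even : ∀ j → sign (2 * j) ≡ 1ℚ
sign-even zero    = refl
sign-even (suc j) rewrite ℕ.+-suc j (j + 0) = trans (-‿involutive (sign (2 * j))) (sign-even j)

kstep-neg : ∀ n j t a b s → kstep n j (- t) (s *ℚ a) (- s *ℚ b) ≡ s *ℚ kstep n j t a b
kstep-neg n j t a b s with n ∸ j
... | zero  = sym (ℚ.*-zeroʳ s)
... | suc m = scale (+ n ℚ./ 1) (+ j ℚ./ 1) (+ 1 ℚ./ suc m) t a b s
  where
  scale : ∀ N J c t a b s → (N *ℚ (- t) *ℚ (- s *ℚ b) - J *ℚ (s *ℚ a)) *ℚ c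
                          ≡ s *ℚ ((N *ℚ t *ℚ b - J *ℚ a) *ℚ c)
  scale = solve 7 (λ N J c t a b s → (N :* (:- t) :* ((:- s) :* b) :- J :* (s :* a)) :* c
                                     := s :* ((N :* t :* b :- J :* a) :* c)) refl

kpair-suc : ∀ n i t → kpair n (suc i) t ≡
  (proj₂ (kpair n i t) , kstep n (suc i) t (proj₁ (kpair n i t)) (proj₂ (kpair n i t)))
kpair-suc n i t with kpair n i t
... | (a , b) = refl

kpair-neg : ∀ n i t → kpair n i (- t) ≡
  (sign i *ℚ proj₁ (kpair n i t) , - sign i *ℚ proj₂ (kpair n i t))
kpair-neg n zero t = cong (1ℚ ,_) (sym (trans (sym (ℚ.neg-distribˡ-* 1ℚ t)) (cong -_ (ℚ.*-identityˡ t))))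
kpair-neg n (suc i) t rewrite kpair-suc n i (- t) | kpair-neg n i t | kpair-suc n i t =
  cong₂ _,_ refl (trans (kstep-neg n (suc i) t a b (sign i))
                     (cong (_*ℚ kstep n (suc i) t a b) (sym (-‿involutive (sign i)))))
  where
  a = proj₁ (kpair n i t)
  b = proj₂ (kpair n i t)

Krawtchouk-neg : ∀ n i t → Krawtchouk n i (- t) ≡ sign i *ℚ Krawtchouk n i t
Krawtchouk-neg n i t = cong proj₁ (kpair-neg n i t)

-- Complementing a point negates the inner product

hamming-comm : {n : ℕ} (x y : F2 n) → hamming x y ≡ hamming y x
hamming-comm []      []      = refl
hamming-comm (a ∷ x) (b ∷ y) = cong₂ (λ c h → (if c then 1 else 0) + h) (Bool.xor-comm a b) (hamming-comm x y)

hamming-negˡ : {n : ℕ} (x y : F2 n) → hamming (neg x) y + hamming x y ≡ n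
hamming-negˡ []          []          = refl
hamming-negˡ (false ∷ x) (false ∷ y) = cong suc (hamming-negˡ x y)
hamming-negˡ (false ∷ x) (true  ∷ y) = trans (ℕ.+-suc _ _) (cong suc (hamming-negˡ x y))
hamming-negˡ (true  ∷ x) (false ∷ y) = trans (ℕ.+-suc _ _) (cong suc (hamming-negˡ x y))
hamming-negˡ (true  ∷ x) (true  ∷ y) = cong suc (hamming-negˡ x y)

fromℚᵘ-homo-+ : ∀ p q → ℚ.fromℚᵘ p +ℚ ℚ.fromℚᵘ q ≡ ℚ.fromℚᵘ (p ℚᵘ.+ q)
fromℚᵘ-homo-+ p q = ℚ.toℚᵘ-injective
  (ℚᵘ.≃-trans (ℚ.toℚᵘ-homo-+ (ℚ.fromℚᵘ p) (ℚ.fromℚᵘ q))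
  (ℚᵘ.≃-trans (ℚᵘ.+-cong (ℚ.toℚᵘ-fromℚᵘ p) (ℚ.toℚᵘ-fromℚᵘ q))
              (ℚᵘ.≃-sym (ℚ.toℚᵘ-fromℚᵘ (p ℚᵘ.+ q)))))

/-+ : ∀ a b m → + a ℚ./ suc m +ℚ + b ℚ./ suc m ≡ + (a + b) ℚ./ suc m
/-+ a b m = trans (fromℚᵘ-homo-+ (ℚᵘ.mkℚᵘ (+ a) m) (ℚᵘ.mkℚᵘ (+ b) m))
                  (ℚ.fromℚᵘ-cong {ℚᵘ.mkℚᵘ (+ a) m ℚᵘ.+ ℚᵘ.mkℚᵘ (+ b) m} {ℚᵘ.mkℚᵘ (+ (a + b)) m}
                    (ℚᵘ.*≡* cross-multiplied))
  where
  open ℤ-Solver.+-*-Solver using () renaming (solve to solveℤ; _:+_ to _⊕_; _:*_ to _⊛_; _:=_ to _≐_)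
  s = suc m
  cross-multiplied : ((+ a ℤ.* + s) ℤ.+ (+ b ℤ.* + s)) ℤ.* + s ≡ + (a + b) ℤ.* + (s * s)
  cross-multiplied =
    trans (solveℤ 3 (λ A B S → ((A ⊛ S) ⊕ (B ⊛ S)) ⊛ S ≐ (A ⊕ B) ⊛ (S ⊛ S)) refl (+ a) (+ b) (+ s))
          (sym (cong₂ ℤ._*_ (ℤ.pos-+ a b) (ℤ.pos-* s s)))

2n/n≡2 : ∀ m → + (2 * suc m) ℚ./ suc m ≡ 1ℚ +ℚ 1ℚ
2n/n≡2 m = ℚ.fromℚᵘ-cong {ℚᵘ.mkℚᵘ (+ (2 * suc m)) m} {ℚᵘ.mkℚᵘ (+ 2) 0} (ℚᵘ.*≡* (trans (cong (ℤ._* + 1) (sym (ℤ.pos-* 2 (suc m))))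
                                          (ℤ.*-identityʳ (+ (2 * suc m)))))

inner-complementary : ∀ m a b → a + b ≡ suc m →
  1ℚ - + (2 * a) ℚ./ suc m ≡ - (1ℚ - + (2 * b) ℚ./ suc m)
inner-complementary m a b a+b≡n = begin
  1ℚ - r                                ≡⟨ rearrange 1ℚ r r′ ⟩
  - (1ℚ - r′) +ℚ ((1ℚ +ℚ 1ℚ) - (r +ℚ r′)) ≡⟨ cong (λ z → - (1ℚ - r′) +ℚ ((1ℚ +ℚ 1ℚ) - z)) r+r′≡2 ⟩
  - (1ℚ - r′) +ℚ ((1ℚ +ℚ 1ℚ) - (1ℚ +ℚ 1ℚ)) ≡⟨ cancel (- (1ℚ - r′)) (1ℚ +ℚ 1ℚ) ⟩
  - (1ℚ - r′) ∎
  where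
  open ≡-Reasoning
  r r′ : ℚ
  r  = + (2 * a) ℚ./ suc m
  r′ = + (2 * b) ℚ./ suc m
  r+r′≡2 : r +ℚ r′ ≡ 1ℚ +ℚ 1ℚ
  r+r′≡2 = trans (/-+ (2 * a) (2 * b) m)
                 (trans (cong (λ z → + z ℚ./ suc m) (trans (sym (ℕ.*-distribˡ-+ 2 a b)) (cong (2 *_) a+b≡n)))
                        (2n/n≡2 m))
  rearrange : ∀ o r r′ → o - r ≡ - (o - r′) +ℚ ((o +ℚ o) - (r +ℚ r′))
  rearrange = solve 3 (λ o r r′ → o :- r := :- (o :- r′) :+ ((o :+ o) :- (r :+ r′))) refl
  cancel : ∀ x c → x +ℚ (c - c) ≡ x
  cancel = solve 2 (λ x c → x :+ (c :- c) := x) refl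

inner-negˡ : (n : ℕ) .{{_ : NonZero n}} (x y : F2 n) → inner n (neg x) y ≡ - inner n x y
inner-negˡ (suc m) x y = inner-complementary m (hamming (neg x) y) (hamming x y) (hamming-negˡ x y)

inner-comm : (n : ℕ) .{{_ : NonZero n}} (x y : F2 n) → inner n x y ≡ inner n y x
inner-comm n x y = cong (λ h → 1ℚ - + (2 * h) ℚ./ n) (hamming-comm x y)

inner-negʳ : (n : ℕ) .{{_ : NonZero n}} (x y : F2 n) → inner n x (neg y) ≡ - inner n x y
inner-negʳ n x y = trans (inner-comm n x (neg y)) (trans (inner-negˡ n y x) (cong -_ (inner-comm n y x)))

-- Moments as quadratic forms

kernel : (n : ℕ) .{{_ : NonZero n}} → ℕ → F2 n → F2 n → ℚ
kernel n i x y = Krawtchouk n i (inner n x y)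

kernel-negˡ : (n : ℕ) .{{_ : NonZero n}} (i : ℕ) (x y : F2 n) →
  kernel n i (neg x) y ≡ sign i *ℚ kernel n i x y
kernel-negˡ n i x y = trans (cong (Krawtchouk n i) (inner-negˡ n x y)) (Krawtchouk-neg n i _)

kernel-negʳ : (n : ℕ) .{{_ : NonZero n}} (i : ℕ) (x y : F2 n) →
  kernel n i x (neg y) ≡ sign i *ℚ kernel n i x y
kernel-negʳ n i x y = trans (cong (Krawtchouk n i) (inner-negʳ n x y)) (Krawtchouk-neg n i _)

𝟙 : Bool → ℚ
𝟙 b = if b then 1ℚ else 0ℚ

if-∧≡𝟙*𝟙 : ∀ a b q → (if a ∧ b then q else 0ℚ) ≡ 𝟙 a *ℚ 𝟙 b *ℚ q
if-∧≡𝟙*𝟙 true  true  q = sym (ℚ.*-identityˡ q)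
if-∧≡𝟙*𝟙 true  false q = sym (ℚ.*-zeroˡ q)
if-∧≡𝟙*𝟙 false true  q = sym (ℚ.*-zeroˡ q)
if-∧≡𝟙*𝟙 false false q = sym (ℚ.*-zeroˡ q)

opaque
  unfolding ∑

  moment≡form : (n : ℕ) .{{_ : NonZero n}} (i : ℕ) (C : Code n) →
    moment n i C ≡ form (kernel n i) (λ x → 𝟙 (C x)) (λ x → 𝟙 (C x))
  moment≡form n i C = ∑-cong (λ x → ∑-cong (λ y → if-∧≡𝟙*𝟙 (C x) (C y) (kernel n i x y)))

IsHalfOf : {n : ℕ} → Code n → Code n → Set
IsHalfOf C D = ∀ x → 𝟙 (D x) ≡ 𝟙 (C x) +ℚ 𝟙 (C (neg x))

module _ {n : ℕ} .{{_ : NonZero n}} (C D : Code n) (C-half : IsHalfOf C D) where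

  moment-half : ∀ i → moment n i D ≡ (1ℚ +ℚ sign i) *ℚ (1ℚ +ℚ sign i) *ℚ moment n i C
  moment-half i = begin
    moment n i D
      ≡⟨ moment≡form n i D ⟩
    form (kernel n i) 𝟙D 𝟙D
      ≡⟨ form-cong (kernel n i) C-half C-half ⟩
    form (kernel n i) 𝟙C± 𝟙C±
      ≡⟨ form-symmetrise (kernel n i) (sign i) (kernel-negˡ n i) (kernel-negʳ n i) 𝟙C ⟩
    (1ℚ +ℚ sign i) *ℚ (1ℚ +ℚ sign i) *ℚ form (kernel n i) 𝟙C 𝟙C
      ≡⟨ cong ((1ℚ +ℚ sign i) *ℚ (1ℚ +ℚ sign i) *ℚ_) (sym (moment≡form n i C)) ⟩
    (1ℚ +ℚ sign i) *ℚ (1ℚ +ℚ sign i) *ℚ moment n i C ∎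
    where
    open ≡-Reasoning
    𝟙C 𝟙D 𝟙C± : F2 n → ℚ
    𝟙C x = 𝟙 (C x)
    𝟙D x = 𝟙 (D x)
    𝟙C± x = 𝟙C x +ℚ 𝟙C (neg x)

  moment-half-even : ∀ j → moment n (2 * j) D ≡ (1ℚ +ℚ 1ℚ) *ℚ (1ℚ +ℚ 1ℚ) *ℚ moment n (2 * j) C
  moment-half-even j =
    trans (moment-half (2 * j)) (cong (λ s → (1ℚ +ℚ s) *ℚ (1ℚ +ℚ s) *ℚ moment n (2 * j) C) (sign-even j))

  moment-half-odd : ∀ j → moment n (suc (2 * j)) D ≡ 0ℚ
  moment-half-odd j = begin
    moment n (suc (2 * j)) D
      ≡⟨ moment-half (suc (2 * j)) ⟩
    (1ℚ +ℚ - sign (2 * j)) *ℚ (1ℚ +ℚ - sign (2 * j)) *ℚ moment n (suc (2 * j)) C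
      ≡⟨ cong (λ s → (1ℚ +ℚ - s) *ℚ (1ℚ +ℚ - s) *ℚ moment n (suc (2 * j)) C) (sign-even j) ⟩
    0ℚ *ℚ 0ℚ *ℚ moment n (suc (2 * j)) C
      ≡⟨ ℚ.*-zeroˡ (moment n (suc (2 * j)) C) ⟩
    0ℚ ∎
    where open ≡-Reasoning

[1+1]*[1+1]*q≡0⇒q≡0 : ∀ q → (1ℚ +ℚ 1ℚ) *ℚ (1ℚ +ℚ 1ℚ) *ℚ q ≡ 0ℚ → q ≡ 0ℚ
[1+1]*[1+1]*q≡0⇒q≡0 q 4q≡0 = trans (divide q) (trans (cong (¼ *ℚ_) 4q≡0) (ℚ.*-zeroʳ ¼))
  where
  ¼ : ℚ
  ¼ = + 1 ℚ./ 4
  divide : ∀ q → q ≡ ¼ *ℚ ((1ℚ +ℚ 1ℚ) *ℚ (1ℚ +ℚ 1ℚ) *ℚ q)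
  divide = solve 1 (λ q → q := con ¼ :* ((con 1ℚ :+ con 1ℚ) :* (con 1ℚ :+ con 1ℚ) :* q)) refl

halfOf-nonempty : {n : ℕ} {C D : Code n} → IsHalfOf C D → NonemptyCode D → NonemptyCode C
halfOf-nonempty {C = C} {D} C-half (x , x∈D) with C x in x∈C | C (neg x) in -x∈C | C-half x
... | true  | _     | _       = x , x∈C
... | false | true  | _       = neg x , -x∈C
... | false | false | 𝟙D≡0 with trans (cong 𝟙 (sym x∈D)) 𝟙D≡0
...   | ()

halfOf-antipodal : {n : ℕ} {C D : Code n} → IsAntipodal D →
  ((x : F2 n) → x ∈C C → x ∈C D) → ((x : F2 n) → x ∈C D → C x ≡ not (C (neg x))) →
  IsHalfOf C D
halfOf-antipodal {C = C} {D} D-antipodal C⊆D C-picks x with C x in x∈C | C (neg x) in -x∈C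
... | true  | true  with trans (sym x∈C) (trans (C-picks x (C⊆D x x∈C)) (cong not -x∈C))
...   | ()
halfOf-antipodal {C = C} {D} D-antipodal C⊆D C-picks x | true  | false rewrite C⊆D x x∈C = refl
halfOf-antipodal {C = C} {D} D-antipodal C⊆D C-picks x | false | true
  rewrite subst (_∈C D) (neg-involutive x) (D-antipodal (neg x) (C⊆D (neg x) -x∈C)) = refl
halfOf-antipodal {C = C} {D} D-antipodal C⊆D C-picks x | false | false with D x in x∈D
... | false = refl
... | true  with trans (sym x∈C) (trans (C-picks x x∈D) (cong not -x∈C))
...   | ()

halfOf-∪neg : {n : ℕ} {C : Code n} → ((x : F2 n) → x ∈C C → neg x ∈C C → ⊥) → IsHalfOf C (C ∪C negC C)
halfOf-∪neg {C = C} no-antipodal-pair x with C x in x∈C | C (neg x) in -x∈C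
... | true  | true  = ⊥-elim (no-antipodal-pair x x∈C -x∈C)
... | true  | false = refl
... | false | true  = refl
... | false | false = refl

∪neg-antipodal : {n : ℕ} (C : Code n) → IsAntipodal (C ∪C negC C)
∪neg-antipodal C x x∈D rewrite neg-involutive x = trans (Bool.∨-comm (C (neg x)) (C x)) x∈D

∪neg-nonempty : {n : ℕ} {C : Code n} → NonemptyCode C → NonemptyCode (C ∪C negC C)
∪neg-nonempty {C = C} (x , x∈C) = x , cong (_∨ C (neg x)) x∈C


even-or-odd : ∀ i → (∃ λ j → i ≡ 2 * j) ⊎ (∃ λ j → i ≡ suc (2 * j))
even-or-odd zero = inj₁ (0 , refl)
even-or-odd (suc i) with even-or-odd i
... | inj₁ (j , i≡2j)  = inj₂ (j , cong suc i≡2j)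
... | inj₂ (j , i≡2j+1) = inj₁ (suc j , trans (cong suc i≡2j+1) (sym (ℕ.*-suc 2 j)))

2j≤2k+1⇒j≤k : ∀ j k → 2 * j ≤ 2 * k + 1 → j ≤ k
2j≤2k+1⇒j≤k zero    k       _ = z≤n
2j≤2k+1⇒j≤k (suc j) zero    h rewrite ℕ.+-suc j (j + 0) with h
... | s≤s ()
2j≤2k+1⇒j≤k (suc j) (suc k) h rewrite ℕ.+-suc j (j + 0) | ℕ.+-suc k (k + 0) with h
... | s≤s (s≤s h′) = s≤s (2j≤2k+1⇒j≤k j k h′)

1≤2j⇒1≤j : ∀ j → 1 ≤ 2 * j → 1 ≤ j
1≤2j⇒1≤j (suc j) _ = s≤s z≤n

halfOf-design-isKKDesign : (n k : ℕ) .{{_ : NonZero n}} → 2 * k ≤ n → {C D : Code n} →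
  IsHalfOf C D → IsDesign n (2 * k + 1) D → IsKKDesign n k C
halfOf-design-isKKDesign n k 2k≤n {C} {D} C-half (D-nonempty , D-design) =
  halfOf-nonempty C-half D-nonempty , C-kk
  where
  C-kk : (j : ℕ) → 1 ≤ j → j ≤ k → moment n (2 * j) C ≡ 0ℚ
  C-kk j 1≤j j≤k = [1+1]*[1+1]*q≡0⇒q≡0 (moment n (2 * j) C)
    (trans (sym (moment-half-even C D C-half j))
           (D-design (2 * j) (ℕ.≤-trans 1≤j (ℕ.m≤n*m j 2)) (ℕ.m≤n⇒m≤n+o 1 2j≤2k) (ℕ.≤-trans 2j≤2k 2k≤n)))
    where
    2j≤2k : 2 * j ≤ 2 * k
    2j≤2k = ℕ.*-monoʳ-≤ 2 j≤k

∪neg-isDesign : (n k : ℕ) .{{_ : NonZero n}} {C : Code n} → IsKKDesign n k C →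
  ((x : F2 n) → x ∈C C → neg x ∈C C → ⊥) → IsDesign n (2 * k + 1) (C ∪C negC C)
∪neg-isDesign n k {C} (C-nonempty , C-kk) no-antipodal-pair = ∪neg-nonempty C-nonempty , D-design
  where
  C-half : IsHalfOf C (C ∪C negC C)
  C-half = halfOf-∪neg {C = C} no-antipodal-pair
  D-design : (i : ℕ) → 1 ≤ i → i ≤ 2 * k + 1 → i ≤ n → moment n i (C ∪C negC C) ≡ 0ℚ
  D-design i 1≤i i≤2k+1 _ with even-or-odd i
  ... | inj₁ (j , refl) =
    trans (moment-half-even C (C ∪C negC C) C-half j)
          (trans (cong ((1ℚ +ℚ 1ℚ) *ℚ (1ℚ +ℚ 1ℚ) *ℚ_) (C-kk j (1≤2j⇒1≤j j 1≤i) (2j≤2k+1⇒j≤k j k i≤2k+1)))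
                 (ℚ.*-zeroʳ ((1ℚ +ℚ 1ℚ) *ℚ (1ℚ +ℚ 1ℚ))))
  ... | inj₂ (j , refl) = moment-half-odd C (C ∪C negC C) C-half j

theorem2p3 : (n k : ℕ) .{{_ : NonZero n}} → 1 ≤ k → 2 * k ≤ n →
    ((D C : Code n) → IsAntipodal D → IsDesign n (2 * k + 1) D →
      ((x : F2 n) → x ∈C C → x ∈C D) →
      ((x : F2 n) → x ∈C D → C x ≡ not (C (neg x))) →
      IsKKDesign n k C)
    × ((C : Code n) → IsKKDesign n k C →
      ((x : F2 n) → x ∈C C → neg x ∈C C → ⊥) →
      IsAntipodal (C ∪C negC C) × IsDesign n (2 * k + 1) (C ∪C negC C))
theorem2p3 n k _ 2k≤n =
  (λ D C D-antipodal D-design C⊆D C-picks →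
     halfOf-design-isKKDesign n k 2k≤n (halfOf-antipodal D-antipodal C⊆D C-picks) D-design)
  , (λ C C-kk no-antipodal-pair → ∪neg-antipodal C , ∪neg-isDesign n k C-kk no-antipodal-pair)
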